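{- Let $i_0, i_1, i_2$ be positive integers such that $\min(n_{i_0}, n_{i_1}) \leq n_{i_2} \leq n_{i_0} + n_{i_1}$. Then the following statements are equivalent: - the prefix of $w$ of length $n_{i_0} + n_{i_1} - n_{i_2}$ is a palindrome; - the vectors $\underline{v}_{i_0}, \underline{v}_{i_1}, \underline{v}_{i_2}$ are linearly dependent. Moreover: - if $i_2 \geq i_1$ and $n_{i_2} \geq n_{i_0} - n_{i_1}$, then these statements hold; - if these statements hold, then, denoting by $i$ the integer such that $n_i = n_{i_0} + n_{i_1} - n_{i_2}$, we have $[\underline{v}_{i_0}, \underline{v}_{i_1}, \underline{v}_{i_2}] = \pm \underline{v}_i$ and $\pi_i = \pi_{i_0} \pi_{i_2}^{ -1} \pi_{i_1}$.
   Context: Let $w = w_1w_2\cdots$ be an infinite, non ultimately periodic word on a finite alphabet $\mathcal{A}$ with $\delta(w) < 2$, where $(n_i)_{i\ge1}$ is the increasing sequence of lengths of palindromic prefixes of $w$, $\pi_i = w_1\cdots w_{n_i}$ is the palindromic prefix of length $n_i$, and $\delta(w) = \limsup n_{i+1}/n_i$. Let $\varphi:\mathcal{A}\to\mathbb{N}^*$ be injective and $\xi = [0, \varphi(w_1), \varphi(w_2), \ldots]$ (continued fraction), with convergents $p_n/q_n$, so that $\begin{bmatrix} q_n & q_{n-1} \\ p_n & p_{n-1}\end{bmatrix} = \prod_{j=1}^n \begin{bmatrix} \varphi(w_j) & 1 \\ 1 & 0\end{bmatrix}$. Put $\underline{v}_i = (q_{n_i}, p_{n_i}, p_{n_i-1})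 \in \mathbb{Z}^3$, identified with the symmetric matrix $\begin{bmatrix} q_{n_i} & p_{n_i} \\ p_{n_i} & p_{n_i-1}\end{bmatrix}$ (symmetric since $\pi_i$ is a palindrome). Roy's bracket of linearly dependent symmetric matrices is $[\underline{x},\underline{y},\underline{z}] = -\underline{x}J\underline{z}J\underline{y}$ with $J = \begin{bmatrix} 0 & 1 \\ -1 & 0\end{bmatrix}$. The word $\pi_{i_0}\pi_{i_2}^{ -1}\pi_{i_1}$ is computed in the free group on $\mathcal{A}$ (it turns out to be a genuine word). -}

module Defs where

open import Data.Nat as ℕ using (ℕ; zero; suc; _<_; _≤_; _≥_)
open import Data.Integer as ℤ using (ℤ; +_; -[1+_])
open import Data.Fin using (Fin; _≟_)
open import Data.Bool using (Bool; true; false; not)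
open import Data.List using (List; []; _∷_; map; reverse; _++_; upTo; foldr)
open import Data.Product using (_×_; _,_; Σ; ∃; ∃-syntax)
open import Data.Sum using (_⊎_)
open import Relation.Binary.PropositionalEquality using (_≡_)
open import Relation.Nullary using (¬_; yes; no)
open import Function.Definitions using (Injective)

-- Words are lists; the infinite word w : ℕ → Fin k is w_1 w_2 ... with
-- w_{j+1} = w j  (0-based indexing of the Agda function).
prefix : ∀ {k} → (ℕ → Fin k) → ℕ → List (Fin k)
prefix w m = map w (upTo m)

IsPalindrome : ∀ {k} → List (Fin k) → Set
IsPalindrome u = reverse u ≡ u

NotUltPeriodic : ∀ {k} → (ℕ → Fin k) → Set
NotUltPeriodic w = ¬ (Σ ℕ λ p → Σ ℕ λ N → 0 < p × (∀ m → N ≤ m → w (m ℕ.+ p) ≡ w m))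

-- n enumerates, increasingly, the lengths of palindromic prefixes of w;
-- convention n 0 = 0 (empty prefix), and n 1 < n 2 < ... are the lengths
-- of the nonempty palindromic prefixes (the paper's (n_i)_{i ≥ 1}).
IsPalPrefixSeq : ∀ {k} → (ℕ → Fin k) → (ℕ → ℕ) → Set
IsPalPrefixSeq w n =
  n 0 ≡ 0 ×
  (∀ i → n i < n (suc i)) ×
  (∀ m → (IsPalindrome (prefix w m) → ∃[ i ] n i ≡ m) × (∀ i → n i ≡ m → IsPalindrome (prefix w m)))

-- δ(w) = limsup n_{i+1}/n_i < 2 : some rational a/b < 2 eventually bounds the ratio
DeltaLt2 : (ℕ → ℕ) → Set
DeltaLt2 n = Σ ℕ λ a → Σ ℕ λ b → a < 2 ℕ.* b ×
  Σ ℕ λ N → ∀ i → N ≤ i → b ℕ.* n (suc i) ≤ a ℕ.* n i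

record Mat2 : Set where
  constructor mat
  field
    a b c d : ℤ

infixl 7 _⊗_
_⊗_ : Mat2 → Mat2 → Mat2
mat a b c d ⊗ mat a' b' c' d' =
  mat (a ℤ.* a' ℤ.+ b ℤ.* c') (a ℤ.* b' ℤ.+ b ℤ.* d')
      (c ℤ.* a' ℤ.+ d ℤ.* c') (c ℤ.* b' ℤ.+ d ℤ.* d')

negM : Mat2 → Mat2
negM (mat a b c d) = mat (ℤ.- a) (ℤ.- b) (ℤ.- c) (ℤ.- d)

idM : Mat2
idM = mat (+ 1) (+ 0) (+ 0) (+ 1)

J : Mat2
J = mat (+ 0) (+ 1) (ℤ.- (+ 1)) (+ 0)

-- ∏_{j=1}^m [[φ(w_j),1],[1,0]] = [[q_m , q_{m-1}],[p_m , p_{m-1}]]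
convMat : ∀ {k} → (Fin k → ℕ) → (ℕ → Fin k) → ℕ → Mat2
convMat φ w zero = idM
convMat φ w (suc m) = convMat φ w m ⊗ mat (+ φ (w m)) (+ 1) (+ 1) (+ 0)

Vec3 : Set
Vec3 = ℤ × ℤ × ℤ

-- v_i = (q_{n_i}, p_{n_i}, p_{n_i - 1})
vvec : ∀ {k} → (Fin k → ℕ) → (ℕ → Fin k) → (ℕ → ℕ) → ℕ → Vec3
vvec φ w n i with convMat φ w (n i)
... | mat q q' p p' = q , p , p'

symMat : Vec3 → Mat2
symMat (x , y , z) = mat x y y z

bracket : Vec3 → Vec3 → Vec3 → Mat2
bracket x y z = negM (symMat x ⊗ J ⊗ symMat z ⊗ J ⊗ symMat y)

-- linear dependence (coefficients in ℤ, equivalently in ℚ or ℝ for integer vectors)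
LinDep : Vec3 → Vec3 → Vec3 → Set
LinDep (x₁ , x₂ , x₃) (y₁ , y₂ , y₃) (z₁ , z₂ , z₃) =
  Σ ℤ λ α → Σ ℤ λ β → Σ ℤ λ γ →
    ¬ (α ≡ + 0 × β ≡ + 0 × γ ≡ + 0) ×
    (α ℤ.* x₁ ℤ.+ β ℤ.* y₁ ℤ.+ γ ℤ.* z₁ ≡ + 0) ×
    (α ℤ.* x₂ ℤ.+ β ℤ.* y₂ ℤ.+ γ ℤ.* z₂ ≡ + 0) ×
    (α ℤ.* x₃ ℤ.+ β ℤ.* y₃ ℤ.+ γ ℤ.* z₃ ≡ + 0)

-- Free group on Fin k: elements represented by freely reduced words over
-- letters (b , x) meaning x if b = true and x⁻¹ if b = false.
Letter : ℕ → Set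
Letter k = Bool × Fin k

cons : ∀ {k} → Letter k → List (Letter k) → List (Letter k)
cons (b , x) [] = (b , x) ∷ []
cons (b , x) ((b' , y) ∷ u) with x ≟ y | b | b'
... | yes _ | true  | false = u
... | yes _ | false | true  = u
... | _     | _     | _     = (b , x) ∷ (b' , y) ∷ u

reduce : ∀ {k} → List (Letter k) → List (Letter k)
reduce = foldr cons []

pos : ∀ {k} → List (Fin k) → List (Letter k)
pos = map (λ x → true , x)

inv : ∀ {k} → List (Letter k) → List (Letter k)
inv u = reverse (map (λ { (b , x) → not b , x }) u)

_≈FG_ : ∀ {k} → List (Letter k) → List (Letter k) → Set
u ≈FG v = reduce u ≡ reduce v

{-# OPTIONS --safe #-}
module Submission where

-- For a word u let M(u) be the product of the matrices [[φ a, 1], [1, 0]] over its letters.  Then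
-- M is a monoid morphism, M(reverse u) = M(u)ᵀ, det M(u) = ±1, and M is injective on words of
-- equal length, so u is a palindrome iff M(u) is symmetric; symMat v_i = M(π_i).
-- On symmetric matrices Roy's bracket is [X, Y, Z] = X · adj Z · Y, and its off-diagonal
-- difference is det(x, y, z).
-- Palindromic prefixes of one word are nested and each is a suffix of the longer ones, so the
-- longest of π₀, π₁, π₂ factors through the other two; in each of the three cases the adjugate
-- cancels and [v₀, v₁, v₂] = ±M(π_L) or ±M(π_L)ᵀ, with L = n₀ + n₁ − n₂.  Hence the bracket is
-- symmetric (the vectors are dependent) iff π_L is a palindrome, and then it is ±v_L; the same
-- factorisations give π_L = π₀ π₂⁻¹ π₁ in the free group.  When n₁ ≤ n₂ the prefix π_L is a border
-- of the palindrome π₁, or r π₁ where π₁ = r y with y a palindrome, and so is a palindrome.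

open import Defs
open import Data.Nat using (ℕ)
open import Data.Fin using (Fin)
open import Data.List using (List; _++_; reverse)
open import Data.Sum using (_⊎_)
open import Relation.Binary.PropositionalEquality using (_≡_)

module Matrix where
  open import Data.Integer using (ℤ; _+_; _*_; _-_; -_; 0ℤ; 1ℤ; -1ℤ)
  import Data.Integer.Properties as ℤ
  open import Data.Integer.Tactic.RingSolver using (solve-∀)
  open import Data.Product using (_,_)
  open import Data.Sum using (inj₁; inj₂; [_,_])
  import Data.Sum as Sum
  open import Function using (id)
  open import Relation.Binary.PropositionalEquality using (refl; sym; trans; cong; module ≡-Reasoning)
  open ≡-Reasoning

  infix 10 _ᵀ
  _ᵀ : Mat2 → Mat2
  mat a b c d ᵀ = mat a c b d

  det : Mat2 → ℤ
  det (mat a b c d) = a * d - b * c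

  adj : Mat2 → Mat2
  adj (mat a b c d) = mat d (- b) (- c) a

  infixr 8 _•_
  _•_ : ℤ → Mat2 → Mat2
  s • mat a b c d = mat (s * a) (s * b) (s * c) (s * d)

  Symmetric : Mat2 → Set
  Symmetric A = A ᵀ ≡ A

  IsUnit : ℤ → Set
  IsUnit s = s ≡ 1ℤ ⊎ s ≡ -1ℤ

  mat-cong : ∀ {a b c d a′ b′ c′ d′} → a ≡ a′ → b ≡ b′ → c ≡ c′ → d ≡ d′ →
             mat a b c d ≡ mat a′ b′ c′ d′
  mat-cong refl refl refl refl = refl

  ⊗-assoc : ∀ A B C → (A ⊗ B) ⊗ C ≡ A ⊗ (B ⊗ C)
  ⊗-assoc (mat a b c d) (mat e f g h) (mat i j k l) =
    mat-cong (entry a b e f g h i k) (entry a b e f g h j l)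
             (entry c d e f g h i k) (entry c d e f g h j l)
    where
    entry : ∀ x y p q r t u v →
            (x * p + y * r) * u + (x * q + y * t) * v ≡ x * (p * u + q * v) + y * (r * u + t * v)
    entry = solve-∀

  ⊗-identityˡ : ∀ A → idM ⊗ A ≡ A
  ⊗-identityˡ (mat a b c d) = mat-cong (first a c) (first b d) (second a c) (second b d)
    where
    first : ∀ x y → 1ℤ * x + 0ℤ * y ≡ x
    first = solve-∀
    second : ∀ x y → 0ℤ * x + 1ℤ * y ≡ y
    second = solve-∀

  ⊗-identityʳ : ∀ A → A ⊗ idM ≡ A
  ⊗-identityʳ (mat a b c d) = mat-cong (first a b) (second a b) (first c d) (second c d)
    where
    first : ∀ x y → x * 1ℤ + y * 0ℤ ≡ x
    first = solve-∀
    second : ∀ x y → x * 0ℤ + y * 1ℤ ≡ y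
    second = solve-∀

  ᵀ-⊗ : ∀ A B → (A ⊗ B) ᵀ ≡ B ᵀ ⊗ A ᵀ
  ᵀ-⊗ (mat a b c d) (mat e f g h) =
    mat-cong (entry a b e g) (entry c d e g) (entry a b f h) (entry c d f h)
    where
    entry : ∀ x y u v → x * u + y * v ≡ u * x + v * y
    entry = solve-∀

  det-⊗ : ∀ A B → det (A ⊗ B) ≡ det A * det B
  det-⊗ (mat a b c d) (mat e f g h) = identity a b c d e f g h
    where
    identity : ∀ a b c d e f g h →
      (a * e + b * g) * (c * f + d * h) - (a * f + b * h) * (c * e + d * g)
      ≡ (a * d - b * c) * (e * h - f * g)
    identity = solve-∀

  adj-⊗ : ∀ A B → adj (A ⊗ B) ≡ adj B ⊗ adj A
  adj-⊗ (mat a b c d) (mat e f g h) =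
    mat-cong (e₁₁ a b c d e f g h) (e₁₂ a b c d e f g h) (e₂₁ a b c d e f g h) (e₂₂ a b c d e f g h)
    where
    e₁₁ : ∀ a b c d e f g h → c * f + d * h ≡ h * d + (- f) * (- c)
    e₁₁ = solve-∀
    e₁₂ : ∀ a b c d e f g h → - (a * f + b * h) ≡ h * (- b) + (- f) * a
    e₁₂ = solve-∀
    e₂₁ : ∀ a b c d e f g h → - (c * e + d * g) ≡ (- g) * d + e * (- c)
    e₂₁ = solve-∀
    e₂₂ : ∀ a b c d e f g h → a * e + b * g ≡ (- g) * (- b) + e * a
    e₂₂ = solve-∀

  adj-inverseʳ : ∀ A → A ⊗ adj A ≡ det A • idM
  adj-inverseʳ (mat a b c d) =
    mat-cong (e₁₁ a b c d) (e₁₂ a b c d) (e₂₁ a b c d) (e₂₂ a b c d)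
    where
    e₁₁ : ∀ a b c d → a * d + b * (- c) ≡ (a * d - b * c) * 1ℤ
    e₁₁ = solve-∀
    e₁₂ : ∀ a b c d → a * (- b) + b * a ≡ (a * d - b * c) * 0ℤ
    e₁₂ = solve-∀
    e₂₁ : ∀ a b c d → c * d + d * (- c) ≡ (a * d - b * c) * 0ℤ
    e₂₁ = solve-∀
    e₂₂ : ∀ a b c d → c * (- b) + d * a ≡ (a * d - b * c) * 1ℤ
    e₂₂ = solve-∀

  adj-inverseˡ : ∀ A → adj A ⊗ A ≡ det A • idM
  adj-inverseˡ (mat a b c d) =
    mat-cong (e₁₁ a b c d) (e₁₂ a b c d) (e₂₁ a b c d) (e₂₂ a b c d)
    where
    e₁₁ : ∀ a b c d → d * a + (- b) * c ≡ (a * d - b * c) * 1ℤ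
    e₁₁ = solve-∀
    e₁₂ : ∀ a b c d → d * b + (- b) * d ≡ (a * d - b * c) * 0ℤ
    e₁₂ = solve-∀
    e₂₁ : ∀ a b c d → (- c) * a + a * c ≡ (a * d - b * c) * 0ℤ
    e₂₁ = solve-∀
    e₂₂ : ∀ a b c d → (- c) * b + a * d ≡ (a * d - b * c) * 1ℤ
    e₂₂ = solve-∀

  •-⊗ : ∀ s A B → (s • A) ⊗ B ≡ s • (A ⊗ B)
  •-⊗ s (mat a b c d) (mat e f g h) =
    mat-cong (entry s a b e g) (entry s a b f h) (entry s c d e g) (entry s c d f h)
    where
    entry : ∀ s x y u v → (s * x) * u + (s * y) * v ≡ s * (x * u + y * v)
    entry = solve-∀

  ⊗-• : ∀ s A B → A ⊗ (s • B) ≡ s • (A ⊗ B)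
  ⊗-• s (mat a b c d) (mat e f g h) =
    mat-cong (entry s a b e g) (entry s a b f h) (entry s c d e g) (entry s c d f h)
    where
    entry : ∀ s x y u v → x * (s * u) + y * (s * v) ≡ s * (x * u + y * v)
    entry = solve-∀

  •-• : ∀ s t A → s • (t • A) ≡ (s * t) • A
  •-• s t (mat a b c d) =
    mat-cong (sym (ℤ.*-assoc s t a)) (sym (ℤ.*-assoc s t b))
             (sym (ℤ.*-assoc s t c)) (sym (ℤ.*-assoc s t d))

  •-identityˡ : ∀ A → 1ℤ • A ≡ A
  •-identityˡ (mat a b c d) =
    mat-cong (ℤ.*-identityˡ a) (ℤ.*-identityˡ b) (ℤ.*-identityˡ c) (ℤ.*-identityˡ d)

  -1•≡negM : ∀ A → -1ℤ • A ≡ negM A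
  -1•≡negM (mat a b c d) = mat-cong (ℤ.-1*i≡-i a) (ℤ.-1*i≡-i b) (ℤ.-1*i≡-i c) (ℤ.-1*i≡-i d)

  J-conjugate : ∀ A → J ⊗ A ⊗ J ≡ negM (adj (A ᵀ))
  J-conjugate (mat a b c d) =
    mat-cong (e₁₁ a b c d) (e₁₂ a b c d) (e₂₁ a b c d) (e₂₂ a b c d)
    where
    e₁₁ : ∀ a b c d → (0ℤ * a + 1ℤ * c) * 0ℤ + (0ℤ * b + 1ℤ * d) * -1ℤ ≡ - d
    e₁₁ = solve-∀
    e₁₂ : ∀ a b c d → (0ℤ * a + 1ℤ * c) * 1ℤ + (0ℤ * b + 1ℤ * d) * 0ℤ ≡ - (- c)
    e₁₂ = solve-∀
    e₂₁ : ∀ a b c d → (-1ℤ * a + 0ℤ * c) * 0ℤ + (-1ℤ * b + 0ℤ * d) * -1ℤ ≡ - (- b)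
    e₂₁ = solve-∀
    e₂₂ : ∀ a b c d → (-1ℤ * a + 0ℤ * c) * 1ℤ + (-1ℤ * b + 0ℤ * d) * 0ℤ ≡ - a
    e₂₂ = solve-∀

  negM-involutive : ∀ A → negM (negM A) ≡ A
  negM-involutive (mat a b c d) =
    mat-cong (ℤ.neg-involutive a) (ℤ.neg-involutive b) (ℤ.neg-involutive c) (ℤ.neg-involutive d)

  ⊗-negM-⊗ : ∀ A M B → A ⊗ negM M ⊗ B ≡ negM (A ⊗ M ⊗ B)
  ⊗-negM-⊗ A M B = begin
    A ⊗ negM M ⊗ B          ≡⟨ cong (λ N → A ⊗ N ⊗ B) (-1•≡negM M) ⟨
    A ⊗ (-1ℤ • M) ⊗ B       ≡⟨ cong (_⊗ B) (⊗-• -1ℤ A M) ⟩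
    (-1ℤ • (A ⊗ M)) ⊗ B     ≡⟨ •-⊗ -1ℤ (A ⊗ M) B ⟩
    -1ℤ • (A ⊗ M ⊗ B)       ≡⟨ -1•≡negM (A ⊗ M ⊗ B) ⟩
    negM (A ⊗ M ⊗ B)        ∎

  ⊗-adj-⊗ : ∀ A B → A ⊗ adj A ⊗ B ≡ det A • B
  ⊗-adj-⊗ A B = begin
    A ⊗ adj A ⊗ B           ≡⟨ cong (_⊗ B) (adj-inverseʳ A) ⟩
    (det A • idM) ⊗ B       ≡⟨ •-⊗ (det A) idM B ⟩
    det A • (idM ⊗ B)       ≡⟨ cong (det A •_) (⊗-identityˡ B) ⟩
    det A • B               ∎

  adj-⊗-⊗ : ∀ A B → adj A ⊗ A ⊗ B ≡ det A • B
  adj-⊗-⊗ A B = begin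
    adj A ⊗ A ⊗ B           ≡⟨ cong (_⊗ B) (adj-inverseˡ A) ⟩
    (det A • idM) ⊗ B       ≡⟨ •-⊗ (det A) idM B ⟩
    det A • (idM ⊗ B)       ≡⟨ cong (det A •_) (⊗-identityˡ B) ⟩
    det A • B               ∎

  adj-cancelˡ : ∀ A B → adj A ⊗ (A ⊗ B) ≡ det A • B
  adj-cancelˡ A B = trans (sym (⊗-assoc (adj A) A B)) (adj-⊗-⊗ A B)

  bracketᴹ : Mat2 → Mat2 → Mat2 → Mat2
  bracketᴹ X Y Z = X ⊗ adj Z ⊗ Y

  bracket≡bracketᴹ : ∀ x y z → bracket x y z ≡ bracketᴹ (symMat x) (symMat y) (symMat z)
  bracket≡bracketᴹ x y z = begin
    negM (X ⊗ J ⊗ Z ⊗ J ⊗ Y)        ≡⟨ cong (λ N → negM (N ⊗ Y)) reassociate ⟩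
    negM (X ⊗ (J ⊗ Z ⊗ J) ⊗ Y)      ≡⟨ cong (λ N → negM (X ⊗ N ⊗ Y)) (J-conjugate Z) ⟩
    negM (X ⊗ negM (adj Z) ⊗ Y)     ≡⟨ cong negM (⊗-negM-⊗ X (adj Z) Y) ⟩
    negM (negM (X ⊗ adj Z ⊗ Y))     ≡⟨ negM-involutive (X ⊗ adj Z ⊗ Y) ⟩
    X ⊗ adj Z ⊗ Y                   ∎
    where
    X = symMat x
    Y = symMat y
    Z = symMat z
    reassociate : X ⊗ J ⊗ Z ⊗ J ≡ X ⊗ (J ⊗ Z ⊗ J)
    reassociate = trans (cong (_⊗ J) (⊗-assoc X J Z)) (⊗-assoc X (J ⊗ Z) J)

  bracketᴹ-outer : ∀ R S X → bracketᴹ S (R ⊗ X) (R ⊗ S) ≡ det S • (det R • X)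
  bracketᴹ-outer R S X = begin
    S ⊗ adj (R ⊗ S) ⊗ (R ⊗ X)        ≡⟨ cong (λ N → S ⊗ N ⊗ (R ⊗ X)) (adj-⊗ R S) ⟩
    S ⊗ (adj S ⊗ adj R) ⊗ (R ⊗ X)    ≡⟨ cong (_⊗ (R ⊗ X)) (⊗-assoc S (adj S) (adj R)) ⟨
    S ⊗ adj S ⊗ adj R ⊗ (R ⊗ X)      ≡⟨ ⊗-assoc (S ⊗ adj S) (adj R) (R ⊗ X) ⟩
    S ⊗ adj S ⊗ (adj R ⊗ (R ⊗ X))    ≡⟨ cong (S ⊗ adj S ⊗_) (⊗-assoc (adj R) R X) ⟨
    S ⊗ adj S ⊗ (adj R ⊗ R ⊗ X)      ≡⟨ cong (S ⊗ adj S ⊗_) (adj-⊗-⊗ R X) ⟩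
    S ⊗ adj S ⊗ (det R • X)          ≡⟨ ⊗-adj-⊗ S (det R • X) ⟩
    det S • (det R • X)              ∎

  bracketᴹ-left : ∀ R S Y → bracketᴹ (R ⊗ S) Y S ≡ det S • (R ⊗ Y)
  bracketᴹ-left R S Y = begin
    R ⊗ S ⊗ adj S ⊗ Y                ≡⟨ cong (_⊗ Y) (⊗-assoc R S (adj S)) ⟩
    R ⊗ (S ⊗ adj S) ⊗ Y              ≡⟨ ⊗-assoc R (S ⊗ adj S) Y ⟩
    R ⊗ (S ⊗ adj S ⊗ Y)              ≡⟨ cong (R ⊗_) (⊗-adj-⊗ S Y) ⟩
    R ⊗ (det S • Y)                  ≡⟨ ⊗-• (det S) R Y ⟩
    det S • (R ⊗ Y)                  ∎

  bracketᴹ-right : ∀ R S X → bracketᴹ X (S ⊗ R) S ≡ det S • (X ⊗ R)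
  bracketᴹ-right R S X = begin
    X ⊗ adj S ⊗ (S ⊗ R)              ≡⟨ ⊗-assoc X (adj S) (S ⊗ R) ⟩
    X ⊗ (adj S ⊗ (S ⊗ R))            ≡⟨ cong (X ⊗_) (⊗-assoc (adj S) S R) ⟨
    X ⊗ (adj S ⊗ S ⊗ R)              ≡⟨ cong (X ⊗_) (adj-⊗-⊗ S R) ⟩
    X ⊗ (det S • R)                  ≡⟨ ⊗-• (det S) X R ⟩
    det S • (X ⊗ R)                  ∎

  IsUnit-* : ∀ {s t} → IsUnit s → IsUnit t → IsUnit (s * t)
  IsUnit-* (inj₁ refl) (inj₁ refl) = inj₁ refl
  IsUnit-* (inj₁ refl) (inj₂ refl) = inj₂ refl
  IsUnit-* (inj₂ refl) (inj₁ refl) = inj₂ refl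
  IsUnit-* (inj₂ refl) (inj₂ refl) = inj₁ refl

  unit-• : ∀ {s} → IsUnit s → ∀ A → s • A ≡ A ⊎ s • A ≡ negM A
  unit-• (inj₁ refl) A = inj₁ (•-identityˡ A)
  unit-• (inj₂ refl) A = inj₂ (-1•≡negM A)

  unit-•-involutive : ∀ {s} → IsUnit s → ∀ A → s • (s • A) ≡ A
  unit-•-involutive (inj₁ refl) A = trans (•-• 1ℤ 1ℤ A) (•-identityˡ A)
  unit-•-involutive (inj₂ refl) A = trans (•-• -1ℤ -1ℤ A) (•-identityˡ A)

  Symmetric-•⁻¹ : ∀ {s} → IsUnit s → ∀ A → Symmetric (s • A) → Symmetric A
  Symmetric-•⁻¹ {s} u A sA = begin
    A ᵀ                ≡⟨ unit-•-involutive u (A ᵀ) ⟨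
    s • (s • A ᵀ)      ≡⟨ cong (s •_) sA ⟩
    s • (s • A)        ≡⟨ unit-•-involutive u A ⟩
    A                  ∎

  unimodular-cancelˡ : ∀ A B C → IsUnit (det A) → A ⊗ B ≡ A ⊗ C → B ≡ C
  unimodular-cancelˡ A B C unit AB≡AC = begin
    B                           ≡⟨ unit-•-involutive unit B ⟨
    det A • (det A • B)         ≡⟨ cong (det A •_) (adj-cancelˡ A B) ⟨
    det A • (adj A ⊗ (A ⊗ B))   ≡⟨ cong (λ M → det A • (adj A ⊗ M)) AB≡AC ⟩
    det A • (adj A ⊗ (A ⊗ C))   ≡⟨ cong (det A •_) (adj-cancelˡ A C) ⟩
    det A • (det A • C)         ≡⟨ unit-•-involutive unit C ⟩
    C                           ∎

  record UnitMultiple (X M : Mat2) : Set where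
    field
      scalar   : ℤ
      unit     : IsUnit scalar
      equation : X ≡ scalar • M ⊎ X ≡ scalar • M ᵀ

  UnitMultiple-transˡ : ∀ {X Y M} → Y ≡ X → UnitMultiple X M → UnitMultiple Y M
  UnitMultiple-transˡ Y≡X record { scalar = s ; unit = u ; equation = inj₁ e } =
    record { scalar = s ; unit = u ; equation = inj₁ (trans Y≡X e) }
  UnitMultiple-transˡ Y≡X record { scalar = s ; unit = u ; equation = inj₂ e } =
    record { scalar = s ; unit = u ; equation = inj₂ (trans Y≡X e) }

  UnitMultiple-Symmetric : ∀ {X M} → UnitMultiple X M → Symmetric M → Symmetric X
  UnitMultiple-Symmetric record { scalar = s ; equation = inj₁ refl } sM = cong (s •_) sM
  UnitMultiple-Symmetric record { scalar = s ; equation = inj₂ refl } sM = cong (s •_) (sym sM)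

  UnitMultiple-Symmetric⁻¹ : ∀ {X M} → UnitMultiple X M → Symmetric X → Symmetric M
  UnitMultiple-Symmetric⁻¹ {M = M} record { unit = u ; equation = inj₁ refl } sX =
    Symmetric-•⁻¹ u M sX
  UnitMultiple-Symmetric⁻¹ {M = M} record { unit = u ; equation = inj₂ refl } sX =
    sym (Symmetric-•⁻¹ u (M ᵀ) sX)

  UnitMultiple-± : ∀ {X M} → UnitMultiple X M → Symmetric M → X ≡ M ⊎ X ≡ negM M
  UnitMultiple-± {X} {M} record { scalar = s ; unit = u ; equation = e } sM =
    Sum.map (trans X≡s•M) (trans X≡s•M) (unit-• u M)
    where
    X≡s•M : X ≡ s • M
    X≡s•M = [ id , (λ X≡s•Mᵀ → trans X≡s•Mᵀ (cong (s •_) sM)) ] e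

  Symmetric⇒b≡c : ∀ A → Symmetric A → Mat2.b A ≡ Mat2.c A
  Symmetric⇒b≡c A sA = sym (cong Mat2.b sA)

  b≡c⇒Symmetric : ∀ A → Mat2.b A ≡ Mat2.c A → Symmetric A
  b≡c⇒Symmetric (mat a b c d) b≡c = mat-cong refl (sym b≡c) b≡c refl

  symMat⁻¹ : Mat2 → Vec3
  symMat⁻¹ (mat a b c d) = a , c , d

  symMat-symMat⁻¹ : ∀ A → Symmetric A → symMat (symMat⁻¹ A) ≡ A
  symMat-symMat⁻¹ (mat a b c d) sA = mat-cong refl (sym (Symmetric⇒b≡c (mat a b c d) sA)) refl refl

module LinearDependence where
  open import Data.Integer using (ℤ; _+_; _*_; _-_; -_; 0ℤ; 1ℤ; _≟_)
  open import Data.Integer.Properties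
    using (i*j≡0⇒i≡0∨j≡0; *-zeroʳ; neg-involutive; i-j≡0⇒i≡j; i≡j⇒i-j≡0)
  open import Data.Integer.Tactic.RingSolver using (solve-∀)
  open import Data.Product using (_×_; _,_; proj₁; proj₂)
  open import Data.Sum using (inj₁; inj₂)
  open import Data.Empty using (⊥-elim)
  open import Function using (_∘_)
  open import Function.Bundles using (_⇔_; mk⇔)
  open import Relation.Nullary using (¬_; yes; no)
  open import Relation.Binary.PropositionalEquality using (refl; sym; trans; cong)
  open Matrix

  det₃ : Vec3 → Vec3 → Vec3 → ℤ
  det₃ (x₁ , x₂ , x₃) (y₁ , y₂ , y₃) (z₁ , z₂ , z₃) =
    x₁ * (y₂ * z₃ - y₃ * z₂) + x₂ * (y₃ * z₁ - y₁ * z₃) + x₃ * (y₁ * z₂ - y₂ * z₁)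

  bracket-b-c≡det₃ : ∀ x y z → Mat2.b (bracket x y z) - Mat2.c (bracket x y z) ≡ det₃ x y z
  bracket-b-c≡det₃ x@(x₁ , x₂ , x₃) y@(y₁ , y₂ , y₃) z@(z₁ , z₂ , z₃) =
    trans (cong (λ M → Mat2.b M - Mat2.c M) (bracket≡bracketᴹ x y z))
          (identity x₁ x₂ x₃ y₁ y₂ y₃ z₁ z₂ z₃)
    where
    identity : ∀ x₁ x₂ x₃ y₁ y₂ y₃ z₁ z₂ z₃ →
      ((x₁ * z₃ + x₂ * - z₂) * y₂ + (x₁ * - z₂ + x₂ * z₁) * y₃)
        - ((x₂ * z₃ + x₃ * - z₂) * y₁ + (x₂ * - z₂ + x₃ * z₁) * y₂)
      ≡ x₁ * (y₂ * z₃ - y₃ * z₂) + x₂ * (y₃ * z₁ - y₁ * z₃) + x₃ * (y₁ * z₂ - y₂ * z₁)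
    identity = solve-∀

  Symmetric-bracket⇒det₃≡0 : ∀ x y z → Symmetric (bracket x y z) → det₃ x y z ≡ 0ℤ
  Symmetric-bracket⇒det₃≡0 x y z s =
    trans (sym (bracket-b-c≡det₃ x y z)) (i≡j⇒i-j≡0 (Symmetric⇒b≡c (bracket x y z) s))

  det₃≡0⇒Symmetric-bracket : ∀ x y z → det₃ x y z ≡ 0ℤ → Symmetric (bracket x y z)
  det₃≡0⇒Symmetric-bracket x y z d≡0 =
    b≡c⇒Symmetric (bracket x y z) (i-j≡0⇒i≡j _ _ (trans (bracket-b-c≡det₃ x y z) d≡0))

  common-factor-zero : ∀ {α β γ D} → ¬ (α ≡ 0ℤ × β ≡ 0ℤ × γ ≡ 0ℤ) →
                       α * D ≡ 0ℤ → β * D ≡ 0ℤ → γ * D ≡ 0ℤ → D ≡ 0ℤ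
  common-factor-zero {α} {β} {γ} nontrivial αD βD γD
    with i*j≡0⇒i≡0∨j≡0 α αD | i*j≡0⇒i≡0∨j≡0 β βD | i*j≡0⇒i≡0∨j≡0 γ γD
  ... | inj₂ D≡0 | _        | _        = D≡0
  ... | _        | inj₂ D≡0 | _        = D≡0
  ... | _        | _        | inj₂ D≡0 = D≡0
  ... | inj₁ α≡0 | inj₁ β≡0 | inj₁ γ≡0 = ⊥-elim (nontrivial (α≡0 , β≡0 , γ≡0))

  LinDep⇒det₃≡0 : ∀ x y z → LinDep x y z → det₃ x y z ≡ 0ℤ
  LinDep⇒det₃≡0 (x₁ , x₂ , x₃) (y₁ , y₂ , y₃) (z₁ , z₂ , z₃) (α , β , γ , nontrivial , e₁ , e₂ , e₃) =
    common-factor-zero nontrivial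
      (trans (α-expansion x₁ x₂ x₃ y₁ y₂ y₃ z₁ z₂ z₃ α β γ)
             (vanishes (y₂ * z₃ - y₃ * z₂) (y₃ * z₁ - y₁ * z₃) (y₁ * z₂ - y₂ * z₁)))
      (trans (β-expansion x₁ x₂ x₃ y₁ y₂ y₃ z₁ z₂ z₃ α β γ)
             (vanishes (z₂ * x₃ - z₃ * x₂) (z₃ * x₁ - z₁ * x₃) (z₁ * x₂ - z₂ * x₁)))
      (trans (γ-expansion x₁ x₂ x₃ y₁ y₂ y₃ z₁ z₂ z₃ α β γ)
             (vanishes (x₂ * y₃ - x₃ * y₂) (x₃ * y₁ - x₁ * y₃) (x₁ * y₂ - x₂ * y₁)))
    where
    vanishes : ∀ c₁ c₂ c₃ → c₁ * (α * x₁ + β * y₁ + γ * z₁) + c₂ * (α * x₂ + β * y₂ + γ * z₂)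
                            + c₃ * (α * x₃ + β * y₃ + γ * z₃) ≡ 0ℤ
    vanishes c₁ c₂ c₃ rewrite e₁ | e₂ | e₃ | *-zeroʳ c₁ | *-zeroʳ c₂ | *-zeroʳ c₃ = refl
    α-expansion : ∀ x₁ x₂ x₃ y₁ y₂ y₃ z₁ z₂ z₃ α β γ →
      α * (x₁ * (y₂ * z₃ - y₃ * z₂) + x₂ * (y₃ * z₁ - y₁ * z₃) + x₃ * (y₁ * z₂ - y₂ * z₁))
      ≡ (y₂ * z₃ - y₃ * z₂) * (α * x₁ + β * y₁ + γ * z₁)
        + (y₃ * z₁ - y₁ * z₃) * (α * x₂ + β * y₂ + γ * z₂)
        + (y₁ * z₂ - y₂ * z₁) * (α * x₃ + β * y₃ + γ * z₃)
    α-expansion = solve-∀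
    β-expansion : ∀ x₁ x₂ x₃ y₁ y₂ y₃ z₁ z₂ z₃ α β γ →
      β * (x₁ * (y₂ * z₃ - y₃ * z₂) + x₂ * (y₃ * z₁ - y₁ * z₃) + x₃ * (y₁ * z₂ - y₂ * z₁))
      ≡ (z₂ * x₃ - z₃ * x₂) * (α * x₁ + β * y₁ + γ * z₁)
        + (z₃ * x₁ - z₁ * x₃) * (α * x₂ + β * y₂ + γ * z₂)
        + (z₁ * x₂ - z₂ * x₁) * (α * x₃ + β * y₃ + γ * z₃)
    β-expansion = solve-∀
    γ-expansion : ∀ x₁ x₂ x₃ y₁ y₂ y₃ z₁ z₂ z₃ α β γ →
      γ * (x₁ * (y₂ * z₃ - y₃ * z₂) + x₂ * (y₃ * z₁ - y₁ * z₃) + x₃ * (y₁ * z₂ - y₂ * z₁))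
      ≡ (x₂ * y₃ - x₃ * y₂) * (α * x₁ + β * y₁ + γ * z₁)
        + (x₃ * y₁ - x₁ * y₃) * (α * x₂ + β * y₂ + γ * z₂)
        + (x₁ * y₂ - x₂ * y₁) * (α * x₃ + β * y₃ + γ * z₃)
    γ-expansion = solve-∀

  rotate : Vec3 → Vec3
  rotate (a , b , c) = b , c , a

  LinDep-rotate⁻¹ : ∀ x y z → LinDep (rotate x) (rotate y) (rotate z) → LinDep x y z
  LinDep-rotate⁻¹ _ _ _ (α , β , γ , nontrivial , e₂ , e₃ , e₁) = α , β , γ , nontrivial , e₁ , e₂ , e₃

  det₃-rotate : ∀ x y z → det₃ (rotate x) (rotate y) (rotate z) ≡ det₃ x y z
  det₃-rotate (x₁ , x₂ , x₃) (y₁ , y₂ , y₃) (z₁ , z₂ , z₃) = identity x₁ x₂ x₃ y₁ y₂ y₃ z₁ z₂ z₃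
    where
    identity : ∀ x₁ x₂ x₃ y₁ y₂ y₃ z₁ z₂ z₃ →
      x₂ * (y₃ * z₁ - y₁ * z₃) + x₃ * (y₁ * z₂ - y₂ * z₁) + x₁ * (y₂ * z₃ - y₃ * z₂)
      ≡ x₁ * (y₂ * z₃ - y₃ * z₂) + x₂ * (y₃ * z₁ - y₁ * z₃) + x₃ * (y₁ * z₂ - y₂ * z₁)
    identity = solve-∀

  cross₁ : Vec3 → Vec3 → ℤ
  cross₁ (x₁ , x₂ , x₃) (y₁ , y₂ , y₃) = x₂ * y₃ - x₃ * y₂

  cofactor-LinDep : ∀ x y z → det₃ x y z ≡ 0ℤ → ¬ cross₁ x y ≡ 0ℤ → LinDep x y z
  cofactor-LinDep (x₁ , x₂ , x₃) (y₁ , y₂ , y₃) (z₁ , z₂ , z₃) d≡0 γ≢0 =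
    y₂ * z₃ - y₃ * z₂ , z₂ * x₃ - z₃ * x₂ , x₂ * y₃ - x₃ * y₂ , γ≢0 ∘ (proj₂ ∘ proj₂) ,
    trans (row₁ x₁ x₂ x₃ y₁ y₂ y₃ z₁ z₂ z₃) d≡0 ,
    row₂ x₁ x₂ x₃ y₁ y₂ y₃ z₁ z₂ z₃ , row₃ x₁ x₂ x₃ y₁ y₂ y₃ z₁ z₂ z₃
    where
    row₁ : ∀ x₁ x₂ x₃ y₁ y₂ y₃ z₁ z₂ z₃ →
      (y₂ * z₃ - y₃ * z₂) * x₁ + (z₂ * x₃ - z₃ * x₂) * y₁ + (x₂ * y₃ - x₃ * y₂) * z₁
      ≡ x₁ * (y₂ * z₃ - y₃ * z₂) + x₂ * (y₃ * z₁ - y₁ * z₃) + x₃ * (y₁ * z₂ - y₂ * z₁)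
    row₁ = solve-∀
    row₂ : ∀ x₁ x₂ x₃ y₁ y₂ y₃ z₁ z₂ z₃ →
      (y₂ * z₃ - y₃ * z₂) * x₂ + (z₂ * x₃ - z₃ * x₂) * y₂ + (x₂ * y₃ - x₃ * y₂) * z₂ ≡ 0ℤ
    row₂ = solve-∀
    row₃ : ∀ x₁ x₂ x₃ y₁ y₂ y₃ z₁ z₂ z₃ →
      (y₂ * z₃ - y₃ * z₂) * x₃ + (z₂ * x₃ - z₃ * x₂) * y₃ + (x₂ * y₃ - x₃ * y₂) * z₃ ≡ 0ℤ
    row₃ = solve-∀

  parallel-LinDep₁ : ∀ x y z → ¬ proj₁ x ≡ 0ℤ →
    cross₁ (rotate x) (rotate y) ≡ 0ℤ → cross₁ (rotate (rotate x)) (rotate (rotate y)) ≡ 0ℤ →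
    LinDep x y z
  parallel-LinDep₁ (x₁ , x₂ , x₃) (y₁ , y₂ , y₃) (z₁ , z₂ , z₃) x₁≢0 c₂ c₃ =
    y₁ , - x₁ , 0ℤ , x₁≢0 ∘ neg≡0 ∘ proj₁ ∘ proj₂ ,
    row₁ x₁ y₁ z₁ , trans (row₂ x₁ x₂ y₁ y₂ z₂) (cong -_ c₃) , trans (row₃ x₁ x₃ y₁ y₃ z₃) c₂
    where
    neg≡0 : - x₁ ≡ 0ℤ → x₁ ≡ 0ℤ
    neg≡0 e = trans (sym (neg-involutive x₁)) (cong -_ e)
    row₁ : ∀ x₁ y₁ z₁ → y₁ * x₁ + - x₁ * y₁ + 0ℤ * z₁ ≡ 0ℤ
    row₁ = solve-∀
    row₂ : ∀ x₁ x₂ y₁ y₂ z₂ → y₁ * x₂ + - x₁ * y₂ + 0ℤ * z₂ ≡ - (x₁ * y₂ - x₂ * y₁)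
    row₂ = solve-∀
    row₃ : ∀ x₁ x₃ y₁ y₃ z₃ → y₁ * x₃ + - x₁ * y₃ + 0ℤ * z₃ ≡ x₃ * y₁ - x₁ * y₃
    row₃ = solve-∀

  parallel-LinDep : ∀ x y z → cross₁ x y ≡ 0ℤ →
    cross₁ (rotate x) (rotate y) ≡ 0ℤ → cross₁ (rotate (rotate x)) (rotate (rotate y)) ≡ 0ℤ →
    LinDep x y z
  parallel-LinDep x@(x₁ , x₂ , x₃) y z c₁ c₂ c₃ with x₁ ≟ 0ℤ | x₂ ≟ 0ℤ | x₃ ≟ 0ℤ
  ... | no x₁≢0 | _         | _         = parallel-LinDep₁ x y z x₁≢0 c₂ c₃
  ... | yes _   | no x₂≢0   | _         =
    LinDep-rotate⁻¹ x y z (parallel-LinDep₁ (rotate x) (rotate y) (rotate z) x₂≢0 c₃ c₁)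
  ... | yes _   | yes _     | no x₃≢0   =
    LinDep-rotate⁻¹ x y z (LinDep-rotate⁻¹ (rotate x) (rotate y) (rotate z)
      (parallel-LinDep₁ (rotate (rotate x)) (rotate (rotate y)) (rotate (rotate z)) x₃≢0 c₁ c₂))
  ... | yes refl | yes refl | yes refl  = 1ℤ , 0ℤ , 0ℤ , (λ { (() , _) }) , refl , refl , refl

  -- Each row of cofactors of (x, y, z) is a dependency, nontrivial when its entry from x × y is
  -- nonzero, and rotating coordinates brings any row to the first; if x × y = 0 then x and y
  -- alone are dependent.
  det₃≡0⇒LinDep : ∀ x y z → det₃ x y z ≡ 0ℤ → LinDep x y z
  det₃≡0⇒LinDep x y z d≡0
    with cross₁ x y ≟ 0ℤ | cross₁ (rotate x) (rotate y) ≟ 0ℤ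
       | cross₁ (rotate (rotate x)) (rotate (rotate y)) ≟ 0ℤ
  ... | no c≢0 | _      | _      = cofactor-LinDep x y z d≡0 c≢0
  ... | yes _  | no c≢0 | _      =
    LinDep-rotate⁻¹ x y z (cofactor-LinDep (rotate x) (rotate y) (rotate z) d′≡0 c≢0)
    where d′≡0 = trans (det₃-rotate x y z) d≡0
  ... | yes _  | yes _  | no c≢0 =
    LinDep-rotate⁻¹ x y z (LinDep-rotate⁻¹ (rotate x) (rotate y) (rotate z)
      (cofactor-LinDep (rotate (rotate x)) (rotate (rotate y)) (rotate (rotate z)) d″≡0 c≢0))
    where d″≡0 = trans (det₃-rotate (rotate x) (rotate y) (rotate z)) (trans (det₃-rotate x y z) d≡0)
  ... | yes c₁ | yes c₂ | yes c₃ = parallel-LinDep x y z c₁ c₂ c₃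

  Symmetric-bracket⇔LinDep : ∀ x y z → Symmetric (bracket x y z) ⇔ LinDep x y z
  Symmetric-bracket⇔LinDep x y z =
    mk⇔ (det₃≡0⇒LinDep x y z ∘ Symmetric-bracket⇒det₃≡0 x y z)
        (det₃≡0⇒Symmetric-bracket x y z ∘ LinDep⇒det₃≡0 x y z)

module Arithmetic where
  open import Data.Nat using (suc; _+_; _*_; _∸_; _≤_; _<_; _≤′_; ≤′-refl; ≤′-step)
  open import Data.Nat.Properties
  open import Data.Empty using (⊥-elim)
  open import Relation.Binary.Definitions using (tri<; tri≈; tri>)
  open import Relation.Binary.PropositionalEquality using (refl; sym; cong; subst; module ≡-Reasoning)

  m+n≡p⇒m+[n+o∸p]≡o : ∀ {m n o p} → m + n ≡ p → p ≤ n + o → m + (n + o ∸ p) ≡ o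
  m+n≡p⇒m+[n+o∸p]≡o {m} {n} {o} refl p≤n+o = begin
    m + (n + o ∸ (m + n))  ≡⟨ cong (λ q → m + (n + o ∸ q)) (+-comm m n) ⟩
    m + (n + o ∸ (n + m))  ≡⟨ cong (m +_) ([m+n]∸[m+o]≡n∸o n o m) ⟩
    m + (o ∸ m)            ≡⟨ m+[n∸m]≡n (+-cancelʳ-≤ n m o (subst (m + n ≤_) (+-comm n o) p≤n+o)) ⟩
    o                      ∎
    where open ≡-Reasoning

  m+n≡p⇒m+o≡p+o∸n : ∀ {m n o p} → m + n ≡ p → m + o ≡ p + o ∸ n
  m+n≡p⇒m+o≡p+o∸n {m} {n} {o} refl = begin
    m + o                  ≡⟨ m+n∸n≡m (m + o) n ⟨
    m + o + n ∸ n          ≡⟨ cong (_∸ n) (+-assoc m o n) ⟩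
    m + (o + n) ∸ n        ≡⟨ cong (λ q → m + q ∸ n) (+-comm o n) ⟩
    m + (n + o) ∸ n        ≡⟨ cong (_∸ n) (+-assoc m n o) ⟨
    m + n + o ∸ n          ∎
    where open ≡-Reasoning

  m+n≡p⇒m+o≡o+p∸n : ∀ {m n o p} → m + n ≡ p → m + o ≡ o + p ∸ n
  m+n≡p⇒m+o≡o+p∸n {m} {n} {o} refl = begin
    m + o                  ≡⟨ +-comm m o ⟩
    o + m                  ≡⟨ m+n∸n≡m (o + m) n ⟨
    o + m + n ∸ n          ≡⟨ cong (_∸ n) (+-assoc o m n) ⟩
    o + (m + n) ∸ n        ∎
    where open ≡-Reasoning

  n≤o⇒m+n∸o≤m : ∀ m {n o} → n ≤ o → m + n ∸ o ≤ m
  n≤o⇒m+n∸o≤m m {n} {o} n≤o = subst (m + n ∸ o ≤_) (m+n∸n≡m m n) (∸-monoʳ-≤ (m + n) n≤o)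

  c<c′⇒c*x+y<c′*x+y′ : ∀ {x c c′ y y′} → c < c′ → y ≤ x → 0 < y′ → c * x + y < c′ * x + y′
  c<c′⇒c*x+y<c′*x+y′ {x} {c} {c′} {y} {y′} c<c′ y≤x 0<y′ = begin-strict
    c * x + y      ≤⟨ +-monoʳ-≤ (c * x) y≤x ⟩
    c * x + x      ≡⟨ +-comm (c * x) x ⟩
    suc c * x      ≤⟨ *-monoˡ-≤ x c<c′ ⟩
    c′ * x         <⟨ m<m+n (c′ * x) 0<y′ ⟩
    c′ * x + y′    ∎
    where open ≤-Reasoning

  quotient-unique : ∀ {x c c′ y y′} → 0 < y → y ≤ x → 0 < y′ → y′ ≤ x → c * x + y ≡ c′ * x + y′ → c ≡ c′
  quotient-unique {c = c} {c′} 0<y y≤x 0<y′ y′≤x eq with <-cmp c c′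
  ... | tri< c<c′ _ _ = ⊥-elim (<-irrefl eq (c<c′⇒c*x+y<c′*x+y′ c<c′ y≤x 0<y′))
  ... | tri≈ _ c≡c′ _ = c≡c′
  ... | tri> _ _ c′<c = ⊥-elim (<-irrefl (sym eq) (c<c′⇒c*x+y<c′*x+y′ c′<c y′≤x 0<y))

  increasing⇒monotone : ∀ (n : ℕ → ℕ) → (∀ i → n i < n (suc i)) → ∀ {i j} → i ≤ j → n i ≤ n j
  increasing⇒monotone n increasing {i} i≤j = go (≤⇒≤′ i≤j)
    where
    go : ∀ {j} → i ≤′ j → n i ≤ n j
    go ≤′-refl         = ≤-refl
    go (≤′-step i≤′j) = ≤-trans (go i≤′j) (<⇒≤ (increasing _))

module Palindromes {a} {A : Set a} where
  open import Data.Nat using (_+_)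
  open import Data.List using (List; []; _∷_; _++_; reverse; take; length)
  open import Data.List.Properties using (reverse-++; ++-assoc; length-reverse)
  open import Relation.Binary.PropositionalEquality
    using (refl; sym; trans; cong; cong₂; module ≡-Reasoning)
  open ≡-Reasoning

  take-length-++ : ∀ (xs ys : List A) n → take (length xs + n) (xs ++ ys) ≡ xs ++ take n ys
  take-length-++ []       ys n = refl
  take-length-++ (x ∷ xs) ys n = cong (x ∷_) (take-length-++ xs ys n)

  take-length : ∀ (xs ys : List A) → take (length xs) (xs ++ ys) ≡ xs
  take-length []       ys = refl
  take-length (x ∷ xs) ys = cong (x ∷_) (take-length xs ys)

  reverse-++-palindrome : ∀ (r v : List A) → reverse v ≡ v → reverse (r ++ v) ≡ v ++ reverse r
  reverse-++-palindrome r v pal = trans (reverse-++ r v) (cong (_++ reverse r) pal)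

  palindrome-prefix⇒suffix : ∀ (u t : List A) → reverse (u ++ t) ≡ u ++ t → reverse u ≡ u →
                             u ++ t ≡ reverse t ++ u
  palindrome-prefix⇒suffix u t pal-ut pal-u = begin
    u ++ t                ≡⟨ pal-ut ⟨
    reverse (u ++ t)      ≡⟨ reverse-++ u t ⟩
    reverse t ++ reverse u ≡⟨ cong (reverse t ++_) pal-u ⟩
    reverse t ++ u        ∎

  palindrome-border : ∀ (p r u : List A) → reverse p ≡ p → p ≡ r ++ u → take (length u) p ≡ u →
                      reverse u ≡ u
  palindrome-border p r u pal p≡ru prefix = begin
    reverse u
      ≡⟨ take-length (reverse u) (reverse r) ⟨
    take (length (reverse u)) (reverse u ++ reverse r)
      ≡⟨ cong₂ take (length-reverse u) (sym (reverse-++ r u)) ⟩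
    take (length u) (reverse (r ++ u))
      ≡⟨ cong (λ v → take (length u) (reverse v)) p≡ru ⟨
    take (length u) (reverse p)
      ≡⟨ cong (take (length u)) pal ⟩
    take (length u) p
      ≡⟨ prefix ⟩
    u ∎

  palindrome-extension : ∀ (p r y : List A) → reverse p ≡ p → p ≡ r ++ y → reverse y ≡ y →
                         reverse (r ++ p) ≡ r ++ p
  palindrome-extension p r y pal-p p≡ry pal-y = begin
    reverse (r ++ p)              ≡⟨ reverse-++-palindrome r p pal-p ⟩
    p ++ reverse r                ≡⟨ cong (_++ reverse r) p≡ry ⟩
    (r ++ y) ++ reverse r         ≡⟨ ++-assoc r y (reverse r) ⟩
    r ++ (y ++ reverse r)         ≡⟨ cong (r ++_) (reverse-++-palindrome r y pal-y) ⟨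
    r ++ reverse (r ++ y)         ≡⟨ cong (λ v → r ++ reverse v) p≡ry ⟨
    r ++ reverse p                ≡⟨ cong (r ++_) pal-p ⟩
    r ++ p                        ∎

-- πₗ stands for the prefix of length |π₀| + |π₁| − |π₂|.  In the last case it is not yet known
-- to be a palindrome, hence the reverse.
data Overlap {a} {A : Set a} (π₀ π₁ π₂ πₗ : List A) : Set a where
  π₂-longest : ∀ r → π₂ ≡ r ++ π₀ → π₁ ≡ r ++ πₗ → Overlap π₀ π₁ π₂ πₗ
  π₀-longest : ∀ r → π₀ ≡ r ++ π₂ → πₗ ≡ r ++ π₁ → Overlap π₀ π₁ π₂ πₗ
  π₁-longest : ∀ r → π₁ ≡ π₂ ++ r → reverse πₗ ≡ π₀ ++ r → Overlap π₀ π₁ π₂ πₗ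

module Prefixes {k} (w : ℕ → Fin k) where
  open import Data.Nat using (suc; _+_; _∸_; _≤_; _⊓_; z≤n; s≤s; _≤?_)
  open import Data.Nat.Properties
    using (≤-trans; m≤n+m; +-monoʳ-≤; +-cancelʳ-≤; +-comm; m∸n≤m; m+[n∸m]≡n; m+1+n≰m; ≰⇒>; <⇒≤; ≤-total;
           m≤n⇒m⊓n≡m; m≥n⇒m⊓n≡n)
  open import Data.List using ([]; _∷_; take; drop; length; map; upTo; applyUpTo)
  open import Data.List.Properties
    using (length-map; length-upTo; length-++; map-upTo; take++drop≡id; upTo-∷ʳ; map-++; ++-identityʳ;
           reverse-involutive)
  open import Data.Product using (∃-syntax; _,_)
  open import Data.Sum using (inj₁; inj₂)
  open import Data.Empty using (⊥-elim)
  open import Function using (_∘_)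
  open import Relation.Nullary using (yes; no)
  open import Relation.Binary.PropositionalEquality
    using (refl; sym; trans; cong; subst; module ≡-Reasoning)
  open ≡-Reasoning
  open Palindromes
  open Arithmetic

  length-prefix : ∀ m → length (prefix w m) ≡ m
  length-prefix m = trans (length-map w (upTo m)) (length-upTo m)

  prefix-suc : ∀ m → prefix w (suc m) ≡ prefix w m ++ w m ∷ []
  prefix-suc m = trans (cong (map w) (sym (upTo-∷ʳ m))) (map-++ w (upTo m) (m ∷ []))

  take-applyUpTo : ∀ {b} {B : Set b} (f : ℕ → B) {l m} → l ≤ m → take l (applyUpTo f m) ≡ applyUpTo f l
  take-applyUpTo f z≤n       = refl
  take-applyUpTo f (s≤s l≤m) = cong (f 0 ∷_) (take-applyUpTo (f ∘ suc) l≤m)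

  take-prefix : ∀ {l m} → l ≤ m → take l (prefix w m) ≡ prefix w l
  take-prefix {l} {m} l≤m = begin
    take l (map w (upTo m))   ≡⟨ cong (take l) (map-upTo w m) ⟩
    take l (applyUpTo w m)    ≡⟨ take-applyUpTo w l≤m ⟩
    applyUpTo w l             ≡⟨ map-upTo w l ⟨
    map w (upTo l)            ∎

  length-split : ∀ {m m′} r → prefix w m ≡ r ++ prefix w m′ → length r + m′ ≡ m
  length-split {m} {m′} r split = begin
    length r + m′                    ≡⟨ cong (length r +_) (length-prefix m′) ⟨
    length r + length (prefix w m′)  ≡⟨ length-++ r ⟨
    length (r ++ prefix w m′)        ≡⟨ cong length split ⟨
    length (prefix w m)              ≡⟨ length-prefix m ⟩
    m                                ∎

  palindromic-prefix-suffix : ∀ {m m′} → m′ ≤ m →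
    IsPalindrome (prefix w m) → IsPalindrome (prefix w m′) → ∃[ r ] prefix w m ≡ r ++ prefix w m′
  palindromic-prefix-suffix {m} {m′} m′≤m pal pal′ =
    reverse t ,
    trans split (palindrome-prefix⇒suffix (prefix w m′) t (subst IsPalindrome split pal) pal′)
    where
    t = drop m′ (prefix w m)
    split : prefix w m ≡ prefix w m′ ++ t
    split = trans (sym (take++drop≡id m′ (prefix w m))) (cong (_++ t) (take-prefix m′≤m))

  prefix-periodic : ∀ {m m′ l} r → prefix w m ≡ r ++ prefix w m′ → l ≤ m′ →
                    prefix w (length r + l) ≡ r ++ prefix w l
  prefix-periodic {m} {m′} {l} r split l≤m′ = begin
    prefix w (length r + l)                 ≡⟨ take-prefix bound ⟨
    take (length r + l) (prefix w m)        ≡⟨ cong (take (length r + l)) split ⟩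
    take (length r + l) (r ++ prefix w m′)  ≡⟨ take-length-++ r (prefix w m′) l ⟩
    r ++ take l (prefix w m′)               ≡⟨ cong (r ++_) (take-prefix l≤m′) ⟩
    r ++ prefix w l                         ∎
    where
    bound : length r + l ≤ m
    bound = subst (length r + l ≤_) (length-split r split) (+-monoʳ-≤ (length r) l≤m′)

  module _ {n₀ n₁ n₂} (P₀ : IsPalindrome (prefix w n₀)) (P₁ : IsPalindrome (prefix w n₁))
           (P₂ : IsPalindrome (prefix w n₂)) where

    private
      π₀ = prefix w n₀
      π₁ = prefix w n₁
      π₂ = prefix w n₂
      L = n₀ + n₁ ∸ n₂
      πₗ = prefix w L

    overlap-π₂-longest : n₀ ≤ n₂ → n₁ ≤ n₂ → n₂ ≤ n₀ + n₁ → Overlap π₀ π₁ π₂ πₗ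
    overlap-π₂-longest n₀≤n₂ n₁≤n₂ upper with palindromic-prefix-suffix n₀≤n₂ P₂ P₀
    ... | r , split = π₂-longest r split (trans (cong (prefix w) (sym length-eq)) periodic)
      where
      periodic : prefix w (length r + L) ≡ r ++ πₗ
      periodic = prefix-periodic r split (n≤o⇒m+n∸o≤m n₀ n₁≤n₂)
      length-eq : length r + L ≡ n₁
      length-eq = m+n≡p⇒m+[n+o∸p]≡o (length-split r split) upper

    overlap-π₀-longest : n₂ ≤ n₀ → n₁ ≤ n₂ → Overlap π₀ π₁ π₂ πₗ
    overlap-π₀-longest n₂≤n₀ n₁≤n₂ with palindromic-prefix-suffix n₂≤n₀ P₀ P₂
    ... | r , split = π₀-longest r split (trans (cong (prefix w) (sym length-eq)) periodic)
      where
      periodic : prefix w (length r + n₁) ≡ r ++ π₁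
      periodic = prefix-periodic r split n₁≤n₂
      length-eq : length r + n₁ ≡ L
      length-eq = m+n≡p⇒m+o≡p+o∸n {o = n₁} (length-split r split)

    overlap-π₁-longest : n₀ ≤ n₂ → n₂ ≤ n₁ → Overlap π₀ π₁ π₂ πₗ
    overlap-π₁-longest n₀≤n₂ n₂≤n₁ with palindromic-prefix-suffix n₂≤n₁ P₁ P₂
    ... | r , split = π₁-longest (reverse r) π₁≡π₂r πₗ-reversed
      where
      periodic : prefix w (length r + n₀) ≡ r ++ π₀
      periodic = prefix-periodic r split n₀≤n₂
      length-eq : length r + n₀ ≡ L
      length-eq = m+n≡p⇒m+o≡o+p∸n {o = n₀} (length-split r split)
      π₁≡π₂r : π₁ ≡ π₂ ++ reverse r
      π₁≡π₂r = trans (sym P₁) (trans (cong reverse split) (reverse-++-palindrome r π₂ P₂))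
      πₗ-reversed : reverse πₗ ≡ π₀ ++ reverse r
      πₗ-reversed = trans (cong reverse (trans (cong (prefix w) (sym length-eq)) periodic))
                          (reverse-++-palindrome r π₀ P₀)

    palindromic-overlap : n₀ ⊓ n₁ ≤ n₂ → n₂ ≤ n₀ + n₁ → Overlap π₀ π₁ π₂ πₗ
    palindromic-overlap lower upper with n₀ ≤? n₂ | n₁ ≤? n₂
    ... | yes n₀≤n₂ | yes n₁≤n₂ = overlap-π₂-longest n₀≤n₂ n₁≤n₂ upper
    ... | yes n₀≤n₂ | no  n₁≰n₂ = overlap-π₁-longest n₀≤n₂ (<⇒≤ (≰⇒> n₁≰n₂))
    ... | no  n₀≰n₂ | _         = overlap-π₀-longest (<⇒≤ (≰⇒> n₀≰n₂)) n₁≤n₂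
      where
      n₁≤n₂ : n₁ ≤ n₂
      n₁≤n₂ with ≤-total n₀ n₁
      ... | inj₁ n₀≤n₁ = ⊥-elim (n₀≰n₂ (subst (_≤ n₂) (m≤n⇒m⊓n≡m n₀≤n₁) lower))
      ... | inj₂ n₁≤n₀ = subst (_≤ n₂) (m≥n⇒m⊓n≡n n₁≤n₀) lower

    overlap-palindrome : n₁ ≤ n₂ → n₀ ≤ n₂ + n₁ → Overlap π₀ π₁ π₂ πₗ → IsPalindrome πₗ
    overlap-palindrome _ _ (π₂-longest r _ π₁≡rπₗ) =
      palindrome-border π₁ r πₗ P₁ π₁≡rπₗ
        (subst (λ m → take m π₁ ≡ πₗ) (sym (length-prefix L))
               (take-prefix (subst (L ≤_) (length-split r π₁≡rπₗ) (m≤n+m L (length r)))))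
    overlap-palindrome n₁≤n₂ n₀≤n₂+n₁ (π₀-longest r π₀≡rπ₂ πₗ≡rπ₁) =
      subst IsPalindrome (sym πₗ≡rπ₁) (palindrome-extension π₁ r y P₁ π₁≡ry y-palindrome)
      where
      r≤n₁ : length r ≤ n₁
      r≤n₁ = +-cancelʳ-≤ n₂ (length r) n₁
               (subst (_≤ n₁ + n₂) (sym (length-split r π₀≡rπ₂)) (subst (n₀ ≤_) (+-comm n₂ n₁) n₀≤n₂+n₁))
      y = prefix w (n₁ ∸ length r)
      π₁≡ry : π₁ ≡ r ++ y
      π₁≡ry = trans (cong (prefix w) (sym (m+[n∸m]≡n r≤n₁)))
                    (prefix-periodic r π₀≡rπ₂ (≤-trans (m∸n≤m n₁ (length r)) n₁≤n₂))
      y-palindrome : IsPalindrome y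
      y-palindrome = palindrome-border π₁ r y P₁ π₁≡ry
        (subst (λ m → take m π₁ ≡ y) (sym (length-prefix (n₁ ∸ length r)))
               (take-prefix (m∸n≤m n₁ (length r))))
    overlap-palindrome n₁≤n₂ _ (π₁-longest [] π₁≡π₂ πₗ-reversed) = begin
      reverse πₗ                 ≡⟨ trans πₗ-reversed (++-identityʳ π₀) ⟩
      π₀                         ≡⟨ P₀ ⟨
      reverse π₀                 ≡⟨ cong reverse (trans πₗ-reversed (++-identityʳ π₀)) ⟨
      reverse (reverse πₗ)       ≡⟨ reverse-involutive πₗ ⟩
      πₗ                         ∎
    overlap-palindrome n₁≤n₂ _ (π₁-longest (x ∷ r) π₁≡π₂r _) =
      ⊥-elim (m+1+n≰m n₂ (subst (_≤ n₂) too-long n₁≤n₂))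
      where
      too-long : n₁ ≡ n₂ + length (x ∷ r)
      too-long = begin
        n₁                                ≡⟨ length-prefix n₁ ⟨
        length π₁                         ≡⟨ cong length π₁≡π₂r ⟩
        length (π₂ ++ x ∷ r)              ≡⟨ length-++ π₂ ⟩
        length π₂ + length (x ∷ r)        ≡⟨ cong (_+ length (x ∷ r)) (length-prefix n₂) ⟩
        n₂ + length (x ∷ r)               ∎

module FreeGroup {k : ℕ} where
  open import Data.Bool using (true; false; not)
  open import Data.Bool.Properties using (not-involutive)
  open import Data.Fin using (_≟_)
  open import Data.List using ([]; _∷_; map; foldr)
  open import Data.List.Properties
    using (foldr-++; map-++; reverse-++; reverse-map; reverse-involutive; map-∘; map-cong; map-id;
           ++-assoc)
  open import Data.Product using (_×_; _,_; proj₁; proj₂; ∃-syntax)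
  open import Data.Sum using (inj₁; inj₂)
  open import Data.Unit using (⊤; tt)
  open import Data.Empty using (⊥-elim)
  open import Function using (_∘_; id)
  open import Relation.Nullary using (yes; no)
  open import Relation.Binary.PropositionalEquality
    using (refl; sym; trans; cong; cong₂; subst; module ≡-Reasoning)
  open ≡-Reasoning

  letter⁻¹ : Letter k → Letter k
  letter⁻¹ (b , x) = not b , x

  letter⁻¹-involutive : ∀ l → letter⁻¹ (letter⁻¹ l) ≡ l
  letter⁻¹-involutive (b , x) = cong (_, x) (not-involutive b)

  Reduced : List (Letter k) → Set
  Reduced []      = ⊤
  Reduced (l ∷ u) = Reduced u × cons l u ≡ l ∷ u

  cons-view : ∀ l u → (∃[ u′ ] u ≡ letter⁻¹ l ∷ u′ × cons l u ≡ u′) ⊎ cons l u ≡ l ∷ u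
  cons-view (b , x) [] = inj₂ refl
  cons-view (b , x) ((b′ , y) ∷ u) with x ≟ y | b | b′
  ... | yes refl | true  | false = inj₁ (u , refl , refl)
  ... | yes refl | false | true  = inj₁ (u , refl , refl)
  ... | yes refl | true  | true  = inj₂ refl
  ... | yes refl | false | false = inj₂ refl
  ... | no _     | _     | _     = inj₂ refl

  cons-cancel : ∀ l u → cons l (letter⁻¹ l ∷ u) ≡ u
  cons-cancel (true , x) u with x ≟ x
  ... | yes _  = refl
  ... | no x≢x = ⊥-elim (x≢x refl)
  cons-cancel (false , x) u with x ≟ x
  ... | yes _  = refl
  ... | no x≢x = ⊥-elim (x≢x refl)

  cons-Reduced : ∀ l u → Reduced u → Reduced (cons l u)
  cons-Reduced l u reduced with cons-view l u
  ... | inj₁ (u′ , refl , cancels) = subst Reduced (sym cancels) (proj₁ reduced)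
  ... | inj₂ keeps                 = subst Reduced (sym keeps) (reduced , keeps)

  reduce-Reduced : ∀ u → Reduced (reduce u)
  reduce-Reduced []      = tt
  reduce-Reduced (l ∷ u) = cons-Reduced l (reduce u) (reduce-Reduced u)

  cons-cons-cancel : ∀ l u → Reduced u → cons l (cons (letter⁻¹ l) u) ≡ u
  cons-cons-cancel l u reduced with cons-view (letter⁻¹ l) u
  ... | inj₁ (u′ , refl , cancels) =
    trans (cong (cons l) cancels)
          (subst (λ m → cons m u′ ≡ letter⁻¹ (letter⁻¹ l) ∷ u′) (letter⁻¹-involutive l) (proj₂ reduced))
  ... | inj₂ keeps = trans (cong (cons l) keeps) (cons-cancel l u)

  ∷-cancel : ∀ l c → (l ∷ letter⁻¹ l ∷ c) ≈FG c
  ∷-cancel l c = cons-cons-cancel l (reduce c) (reduce-Reduced c)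

  ++-congˡ : ∀ (a : List (Letter k)) u v → u ≈FG v → (a ++ u) ≈FG (a ++ v)
  ++-congˡ a u v u≈v = begin
    reduce (a ++ u)              ≡⟨ foldr-++ cons [] a u ⟩
    foldr cons (reduce u) a      ≡⟨ cong (λ r → foldr cons r a) u≈v ⟩
    foldr cons (reduce v) a      ≡⟨ foldr-++ cons [] a v ⟨
    reduce (a ++ v)              ∎

  inv-++ : ∀ u v → inv (u ++ v) ≡ inv v ++ inv u
  inv-++ u v = trans (cong reverse (map-++ letter⁻¹ u v)) (reverse-++ (map letter⁻¹ u) (map letter⁻¹ v))

  inv-involutive : ∀ u → inv (inv u) ≡ u
  inv-involutive u = begin
    reverse (map letter⁻¹ (reverse (map letter⁻¹ u)))
      ≡⟨ cong reverse (reverse-map letter⁻¹ (map letter⁻¹ u)) ⟩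
    reverse (reverse (map letter⁻¹ (map letter⁻¹ u)))
      ≡⟨ reverse-involutive (map letter⁻¹ (map letter⁻¹ u)) ⟩
    map letter⁻¹ (map letter⁻¹ u)
      ≡⟨ map-∘ u ⟨
    map (letter⁻¹ ∘ letter⁻¹) u
      ≡⟨ map-cong letter⁻¹-involutive u ⟩
    map id u
      ≡⟨ map-id u ⟩
    u ∎

  ++-inv-cancel : ∀ y c → (y ++ inv y ++ c) ≈FG c
  ++-inv-cancel []      c = refl
  ++-inv-cancel (l ∷ y) c = begin
    reduce (l ∷ y ++ inv (l ∷ y) ++ c)          ≡⟨ cong (λ t → reduce (l ∷ y ++ t)) inv-∷-++ ⟩
    reduce (l ∷ y ++ inv y ++ letter⁻¹ l ∷ c)   ≡⟨ cong (cons l) (++-inv-cancel y (letter⁻¹ l ∷ c)) ⟩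
    reduce (l ∷ letter⁻¹ l ∷ c)                 ≡⟨ ∷-cancel l c ⟩
    reduce c                                    ∎
    where
    inv-∷-++ : inv (l ∷ y) ++ c ≡ inv y ++ letter⁻¹ l ∷ c
    inv-∷-++ = trans (cong (_++ c) (inv-++ (l ∷ []) y)) (++-assoc (inv y) (letter⁻¹ l ∷ []) c)

  inv-++-cancel : ∀ y c → (inv y ++ y ++ c) ≈FG c
  inv-++-cancel y c = subst (λ z → (inv y ++ z ++ c) ≈FG c) (inv-involutive y) (++-inv-cancel (inv y) c)

  pos-++ : ∀ (u v : List (Fin k)) → pos (u ++ v) ≡ pos u ++ pos v
  pos-++ = map-++ (true ,_)

  overlap-≈FG : ∀ {π₀ π₁ π₂ πₗ : List (Fin k)} → Overlap π₀ π₁ π₂ πₗ → reverse πₗ ≡ πₗ →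
                pos πₗ ≈FG (pos π₀ ++ inv (pos π₂) ++ pos π₁)
  overlap-≈FG {π₀} {πₗ = πₗ} (π₂-longest r refl refl) _ = sym (begin
    reduce (pos π₀ ++ inv (pos (r ++ π₀)) ++ pos (r ++ πₗ))
      ≡⟨ cong₂ (λ s t → reduce (pos π₀ ++ inv s ++ t)) (pos-++ r π₀) (pos-++ r πₗ) ⟩
    reduce (pos π₀ ++ inv (pos r ++ pos π₀) ++ pos r ++ pos πₗ)
      ≡⟨ cong (λ s → reduce (pos π₀ ++ s ++ pos r ++ pos πₗ)) (inv-++ (pos r) (pos π₀)) ⟩
    reduce (pos π₀ ++ (inv (pos π₀) ++ inv (pos r)) ++ pos r ++ pos πₗ)
      ≡⟨ cong (λ s → reduce (pos π₀ ++ s)) (++-assoc (inv (pos π₀)) (inv (pos r)) (pos r ++ pos πₗ)) ⟩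
    reduce (pos π₀ ++ inv (pos π₀) ++ inv (pos r) ++ pos r ++ pos πₗ)
      ≡⟨ ++-inv-cancel (pos π₀) (inv (pos r) ++ pos r ++ pos πₗ) ⟩
    reduce (inv (pos r) ++ pos r ++ pos πₗ)
      ≡⟨ inv-++-cancel (pos r) (pos πₗ) ⟩
    reduce (pos πₗ) ∎)
  overlap-≈FG {π₁ = π₁} {π₂} (π₀-longest r refl refl) _ = sym (begin
    reduce (pos (r ++ π₂) ++ inv (pos π₂) ++ pos π₁)
      ≡⟨ cong (λ s → reduce (s ++ inv (pos π₂) ++ pos π₁)) (pos-++ r π₂) ⟩
    reduce ((pos r ++ pos π₂) ++ inv (pos π₂) ++ pos π₁)
      ≡⟨ cong reduce (++-assoc (pos r) (pos π₂) (inv (pos π₂) ++ pos π₁)) ⟩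
    reduce (pos r ++ pos π₂ ++ inv (pos π₂) ++ pos π₁)
      ≡⟨ ++-congˡ (pos r) _ (pos π₁) (++-inv-cancel (pos π₂) (pos π₁)) ⟩
    reduce (pos r ++ pos π₁)
      ≡⟨ cong reduce (pos-++ r π₁) ⟨
    reduce (pos (r ++ π₁)) ∎)
  overlap-≈FG {π₀} {π₂ = π₂} {πₗ} (π₁-longest r refl πₗ-reversed) palindrome = begin
    reduce (pos πₗ)
      ≡⟨ cong (reduce ∘ pos) (trans (sym palindrome) πₗ-reversed) ⟩
    reduce (pos (π₀ ++ r))
      ≡⟨ cong reduce (pos-++ π₀ r) ⟩
    reduce (pos π₀ ++ pos r)
      ≡⟨ ++-congˡ (pos π₀) _ (pos r) (inv-++-cancel (pos π₂) (pos r)) ⟨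
    reduce (pos π₀ ++ inv (pos π₂) ++ pos π₂ ++ pos r)
      ≡⟨ cong (λ s → reduce (pos π₀ ++ inv (pos π₂) ++ s)) (pos-++ π₂ r) ⟨
    reduce (pos π₀ ++ inv (pos π₂) ++ pos (π₂ ++ r)) ∎

module ContinuedFractions {k} (φ : Fin k → ℕ) where
  open import Data.Nat as ℕ using (suc; zero; z≤n; s≤s)
  import Data.Nat.Properties as ℕ
  open import Data.Integer using (+_; _+_; _*_; _-_; 1ℤ; -1ℤ)
  open import Data.Integer.Properties
    using (*-identityˡ; +-identityʳ; *-zeroʳ; pos-+; pos-*; +-injective)
  open import Data.List using ([]; _∷_; length)
  open import Data.List.Properties using (unfold-reverse; length-reverse)
  open import Data.Product using (Σ; _×_; _,_)
  open import Data.Sum using (inj₁; inj₂)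
  open import Function.Definitions using (Injective)
  open import Relation.Binary.PropositionalEquality
    using (refl; sym; trans; cong; cong₂; subst; module ≡-Reasoning)
  open ≡-Reasoning
  open Matrix
  open Arithmetic using (quotient-unique)

  quotientMat : Fin k → Mat2
  quotientMat a = mat (+ φ a) (+ 1) (+ 1) (+ 0)

  wordMat : List (Fin k) → Mat2
  wordMat []      = idM
  wordMat (a ∷ u) = quotientMat a ⊗ wordMat u

  wordMat-++ : ∀ u v → wordMat (u ++ v) ≡ wordMat u ⊗ wordMat v
  wordMat-++ []      v = sym (⊗-identityˡ (wordMat v))
  wordMat-++ (a ∷ u) v =
    trans (cong (quotientMat a ⊗_) (wordMat-++ u v))
          (sym (⊗-assoc (quotientMat a) (wordMat u) (wordMat v)))

  convMat≡wordMat : ∀ w m → convMat φ w m ≡ wordMat (prefix w m)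
  convMat≡wordMat w zero    = refl
  convMat≡wordMat w (suc m) = begin
    convMat φ w m ⊗ quotientMat (w m)
      ≡⟨ cong₂ _⊗_ (convMat≡wordMat w m) (sym (⊗-identityʳ (quotientMat (w m)))) ⟩
    wordMat (prefix w m) ⊗ wordMat (w m ∷ [])
      ≡⟨ wordMat-++ (prefix w m) (w m ∷ []) ⟨
    wordMat (prefix w m ++ w m ∷ [])
      ≡⟨ cong wordMat (Prefixes.prefix-suc w m) ⟨
    wordMat (prefix w (suc m)) ∎

  wordMat-reverse : ∀ u → wordMat (reverse u) ≡ wordMat u ᵀ
  wordMat-reverse []      = refl
  wordMat-reverse (a ∷ u) = begin
    wordMat (reverse (a ∷ u))
      ≡⟨ cong wordMat (unfold-reverse a u) ⟩
    wordMat (reverse u ++ a ∷ [])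
      ≡⟨ wordMat-++ (reverse u) (a ∷ []) ⟩
    wordMat (reverse u) ⊗ wordMat (a ∷ [])
      ≡⟨ cong₂ _⊗_ (wordMat-reverse u) (⊗-identityʳ (quotientMat a)) ⟩
    wordMat u ᵀ ⊗ quotientMat a ᵀ
      ≡⟨ ᵀ-⊗ (quotientMat a) (wordMat u) ⟨
    (quotientMat a ⊗ wordMat u) ᵀ ∎

  det-quotientMat : ∀ a → det (quotientMat a) ≡ -1ℤ
  det-quotientMat a = cong (_- 1ℤ) (*-zeroʳ (+ φ a))

  det-wordMat : ∀ u → IsUnit (det (wordMat u))
  det-wordMat []      = inj₁ refl
  det-wordMat (a ∷ u) = subst IsUnit (sym (det-⊗ (quotientMat a) (wordMat u)))
                              (IsUnit-* (inj₂ (det-quotientMat a)) (det-wordMat u))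

  palindrome⇒Symmetric : ∀ u → reverse u ≡ u → Symmetric (wordMat u)
  palindrome⇒Symmetric u pal = trans (sym (wordMat-reverse u)) (cong wordMat pal)

  overlap-bracket : ∀ {π₀ π₁ π₂ πₗ} → Overlap π₀ π₁ π₂ πₗ →
                    UnitMultiple (bracketᴹ (wordMat π₀) (wordMat π₁) (wordMat π₂)) (wordMat πₗ)
  overlap-bracket {π₀} {πₗ = πₗ} (π₂-longest r refl refl) =
    record { scalar = det S * det R ; unit = IsUnit-* (det-wordMat π₀) (det-wordMat r)
           ; equation = inj₁ (begin
      bracketᴹ S (wordMat (r ++ πₗ)) (wordMat (r ++ π₀))
        ≡⟨ cong₂ (bracketᴹ S) (wordMat-++ r πₗ) (wordMat-++ r π₀) ⟩
      bracketᴹ S (R ⊗ X) (R ⊗ S)    ≡⟨ bracketᴹ-outer R S X ⟩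
      det S • (det R • X)           ≡⟨ •-• (det S) (det R) X ⟩
      (det S * det R) • X           ∎) }
    where
    R = wordMat r
    S = wordMat π₀
    X = wordMat πₗ
  overlap-bracket {π₁ = π₁} {π₂} (π₀-longest r refl refl) =
    record { scalar = det S ; unit = det-wordMat π₂ ; equation = inj₁ (begin
      bracketᴹ (wordMat (r ++ π₂)) Y S   ≡⟨ cong (λ M → bracketᴹ M Y S) (wordMat-++ r π₂) ⟩
      bracketᴹ (R ⊗ S) Y S               ≡⟨ bracketᴹ-left R S Y ⟩
      det S • (R ⊗ Y)                    ≡⟨ cong (det S •_) (wordMat-++ r π₁) ⟨
      det S • wordMat (r ++ π₁)          ∎) }
    where
    R = wordMat r
    S = wordMat π₂
    Y = wordMat π₁
  overlap-bracket {π₀} {π₂ = π₂} {πₗ} (π₁-longest r refl πₗ-reversed) =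
    record { scalar = det S ; unit = det-wordMat π₂ ; equation = inj₂ (begin
      bracketᴹ X (wordMat (π₂ ++ r)) S   ≡⟨ cong (λ M → bracketᴹ X M S) (wordMat-++ π₂ r) ⟩
      bracketᴹ X (S ⊗ R) S               ≡⟨ bracketᴹ-right R S X ⟩
      det S • (X ⊗ R)                    ≡⟨ cong (det S •_) (wordMat-++ π₀ r) ⟨
      det S • wordMat (π₀ ++ r)          ≡⟨ cong (λ u → det S • wordMat u) πₗ-reversed ⟨
      det S • wordMat (reverse πₗ)       ≡⟨ cong (det S •_) (wordMat-reverse πₗ) ⟩
      det S • wordMat πₗ ᵀ               ∎) }
    where
    R = wordMat r
    S = wordMat π₂
    X = wordMat π₀

  module _ (φ-injective : Injective _≡_ _≡_ φ) (φ≥1 : ∀ a → 1 ℕ.≤ φ a) where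

    top-left : ∀ a M {q p} → Mat2.a M ≡ + q → Mat2.c M ≡ + p →
               Mat2.a (quotientMat a ⊗ M) ≡ + (φ a ℕ.* q ℕ.+ p)
    top-left a (mat _ _ _ _) {q} {p} refl refl = begin
      + φ a * + q + 1ℤ * + p     ≡⟨ cong (λ t → + φ a * + q + t) (*-identityˡ (+ p)) ⟩
      + φ a * + q + + p          ≡⟨ cong (_+ + p) (pos-* (φ a) q) ⟨
      + (φ a ℕ.* q) + + p        ≡⟨ pos-+ (φ a ℕ.* q) p ⟨
      + (φ a ℕ.* q ℕ.+ p)        ∎

    bottom-left : ∀ a M → Mat2.c (quotientMat a ⊗ M) ≡ Mat2.a M
    bottom-left a (mat q _ p _) = trans (+-identityʳ (1ℤ * q)) (*-identityˡ q)

    first-column : ∀ a u → Σ ℕ λ q → Σ ℕ λ p →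
      Mat2.a (wordMat (a ∷ u)) ≡ + q × Mat2.c (wordMat (a ∷ u)) ≡ + p × 0 ℕ.< p × p ℕ.≤ q
    first-column a [] =
      φ a , 1 , cong Mat2.a (⊗-identityʳ (quotientMat a)) , cong Mat2.c (⊗-identityʳ (quotientMat a)) ,
      s≤s z≤n , φ≥1 a
    first-column a (b ∷ u) with first-column b u
    ... | q , p , a≡q , c≡p , 0<p , p≤q =
      φ a ℕ.* q ℕ.+ p , q , top-left a (wordMat (b ∷ u)) a≡q c≡p ,
      trans (bottom-left a (wordMat (b ∷ u))) a≡q , ℕ.≤-trans 0<p p≤q , q≤φa*q+p
      where
      q≤φa*q+p : q ℕ.≤ φ a ℕ.* q ℕ.+ p
      q≤φa*q+p = ℕ.≤-trans (ℕ.≤-trans (ℕ.≤-reflexive (sym (ℕ.*-identityˡ q))) (ℕ.*-monoˡ-≤ q (φ≥1 a)))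
                           (ℕ.m≤m+n (φ a ℕ.* q) p)

    -- The first column (q, p) of a nonempty wordMat has 0 < p ≤ q, so the top-left entry
    -- φ a · q + p of quotientMat a ⊗ wordMat u determines φ a.
    head-unique : ∀ a b u v → length u ≡ length v →
                  quotientMat a ⊗ wordMat u ≡ quotientMat b ⊗ wordMat v → φ a ≡ φ b
    head-unique a b [] [] _ eq =
      +-injective (cong Mat2.a (trans (sym (⊗-identityʳ (quotientMat a)))
                                      (trans eq (⊗-identityʳ (quotientMat b)))))
    head-unique a b (c ∷ u) (d ∷ v) _ eq
      with first-column c u | first-column d v
    ... | q , p , a≡q , c≡p , 0<p , p≤q | q′ , p′ , a≡q′ , c≡p′ , 0<p′ , p′≤q′ =
      quotient-unique 0<p p≤q 0<p′ (subst (p′ ℕ.≤_) (sym q≡q′) p′≤q′) (+-injective (begin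
        + (φ a ℕ.* q ℕ.+ p)                       ≡⟨ top-left a (wordMat (c ∷ u)) a≡q c≡p ⟨
        Mat2.a (quotientMat a ⊗ wordMat (c ∷ u))  ≡⟨ cong Mat2.a eq ⟩
        Mat2.a (quotientMat b ⊗ wordMat (d ∷ v))
          ≡⟨ top-left b (wordMat (d ∷ v)) (trans a≡q′ (cong +_ (sym q≡q′))) c≡p′ ⟩
        + (φ b ℕ.* q ℕ.+ p′)                      ∎))
      where
      q≡q′ : q ≡ q′
      q≡q′ = +-injective (begin
        + q                                       ≡⟨ a≡q ⟨
        Mat2.a (wordMat (c ∷ u))                  ≡⟨ bottom-left a (wordMat (c ∷ u)) ⟨
        Mat2.c (quotientMat a ⊗ wordMat (c ∷ u))  ≡⟨ cong Mat2.c eq ⟩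
        Mat2.c (quotientMat b ⊗ wordMat (d ∷ v))  ≡⟨ bottom-left b (wordMat (d ∷ v)) ⟩
        Mat2.a (wordMat (d ∷ v))                  ≡⟨ a≡q′ ⟩
        + q′                                      ∎)

    wordMat-injective : ∀ u v → length u ≡ length v → wordMat u ≡ wordMat v → u ≡ v
    wordMat-injective []      []      _   _  = refl
    wordMat-injective (a ∷ u) (b ∷ v) len eq =
      cong₂ _∷_ a≡b (wordMat-injective u v (ℕ.suc-injective len) tails)
      where
      a≡b : a ≡ b
      a≡b = φ-injective (head-unique a b u v (ℕ.suc-injective len) eq)
      tails : wordMat u ≡ wordMat v
      tails = unimodular-cancelˡ (quotientMat a) (wordMat u) (wordMat v) (inj₂ (det-quotientMat a))
                (trans eq (cong (λ c → quotientMat c ⊗ wordMat v) (sym a≡b)))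

    Symmetric⇒palindrome : ∀ u → Symmetric (wordMat u) → reverse u ≡ u
    Symmetric⇒palindrome u sym-u =
      wordMat-injective (reverse u) u (length-reverse u) (trans (wordMat-reverse u) sym-u)

open import Data.Nat using (_≤_; _+_; _∸_; _⊓_; suc)
open import Data.Product using (_×_; _,_; proj₂)
import Data.Sum as Sum
open import Function using (_∘_)
open import Function.Bundles using (_⇔_; mk⇔)
open import Function.Construct.Composition using (_⇔-∘_)
open import Function.Construct.Symmetry using (⇔-sym)
open import Function.Definitions using (Injective)
open import Relation.Binary.PropositionalEquality using (refl; sym; trans; cong; cong₂; subst)
open Matrix
open LinearDependence
open FreeGroup using (overlap-≈FG)
open Arithmetic using (increasing⇒monotone)

module Remainder {k} {φ : Fin k → ℕ} (φ-injective : Injective _≡_ _≡_ φ) (φ≥1 : ∀ a → 1 ≤ φ a)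
                 (w : ℕ → Fin k) {n₀ n₁ n₂ : ℕ}
                 (P₀ : IsPalindrome (prefix w n₀)) (P₁ : IsPalindrome (prefix w n₁))
                 (P₂ : IsPalindrome (prefix w n₂)) (lower : n₀ ⊓ n₁ ≤ n₂) (upper : n₂ ≤ n₀ + n₁) where
  open ContinuedFractions φ
  open Prefixes w

  L : ℕ
  L = n₀ + n₁ ∸ n₂

  πₗ : List (Fin k)
  πₗ = prefix w L

  Mₗ : Mat2
  Mₗ = wordMat πₗ

  -- vvec φ w n i is definitionally vec (n i).
  vec : ℕ → Vec3
  vec m = symMat⁻¹ (convMat φ w m)

  B : Mat2
  B = bracket (vec n₀) (vec n₁) (vec n₂)

  symMat-vec : ∀ {m} → IsPalindrome (prefix w m) → symMat (vec m) ≡ wordMat (prefix w m)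
  symMat-vec {m} pal = trans (symMat-symMat⁻¹ (convMat φ w m) symmetric) (convMat≡wordMat w m)
    where
    symmetric : Symmetric (convMat φ w m)
    symmetric = subst Symmetric (sym (convMat≡wordMat w m)) (palindrome⇒Symmetric (prefix w m) pal)

  configuration : Overlap (prefix w n₀) (prefix w n₁) (prefix w n₂) πₗ
  configuration = palindromic-overlap P₀ P₁ P₂ lower upper

  bracket-remainder : UnitMultiple B Mₗ
  bracket-remainder = UnitMultiple-transˡ B≡ (overlap-bracket configuration)
    where
    B≡ : B ≡ bracketᴹ (wordMat (prefix w n₀)) (wordMat (prefix w n₁)) (wordMat (prefix w n₂))
    B≡ = trans (bracket≡bracketᴹ (vec n₀) (vec n₁) (vec n₂))
               (trans (cong₂ (λ X Y → bracketᴹ X Y (symMat (vec n₂))) (symMat-vec P₀) (symMat-vec P₁))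
                      (cong (bracketᴹ (wordMat (prefix w n₀)) (wordMat (prefix w n₁))) (symMat-vec P₂)))

  Symmetric-bracket⇔palindrome : Symmetric B ⇔ IsPalindrome πₗ
  Symmetric-bracket⇔palindrome =
    mk⇔ (Symmetric⇒palindrome φ-injective φ≥1 πₗ ∘ UnitMultiple-Symmetric⁻¹ bracket-remainder)
        (UnitMultiple-Symmetric bracket-remainder ∘ palindrome⇒Symmetric πₗ)

  remainder-identities : IsPalindrome πₗ → ∀ m → m ≡ L →
    (B ≡ symMat (vec m) ⊎ B ≡ negM (symMat (vec m))) ×
    (pos (prefix w m) ≈FG (pos (prefix w n₀) ++ inv (pos (prefix w n₂)) ++ pos (prefix w n₁)))
  remainder-identities pal m refl =
    Sum.map (λ B≡Mₗ → trans B≡Mₗ Mₗ≡) (λ B≡-Mₗ → trans B≡-Mₗ (cong negM Mₗ≡))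
            (UnitMultiple-± bracket-remainder (palindrome⇒Symmetric πₗ pal)) ,
    overlap-≈FG configuration pal
    where
    Mₗ≡ : Mₗ ≡ symMat (vec L)
    Mₗ≡ = sym (symMat-vec pal)

  palindromic-remainder : n₁ ≤ n₂ → n₀ ≤ n₂ + n₁ → IsPalindrome πₗ
  palindromic-remainder n₁≤n₂ n₀≤n₂+n₁ = overlap-palindrome P₀ P₁ P₂ n₁≤n₂ n₀≤n₂+n₁ configuration

lemma5p5 : (k : ℕ) (w : ℕ → Fin k) (φ : Fin k → ℕ) (n : ℕ → ℕ) →
  NotUltPeriodic w → IsPalPrefixSeq w n → DeltaLt2 n →
  Injective _≡_ _≡_ φ → (∀ a → 1 ≤ φ a) →
  (i₀ i₁ i₂ : ℕ) → 1 ≤ i₀ → 1 ≤ i₁ → 1 ≤ i₂ →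
  n i₀ ⊓ n i₁ ≤ n i₂ → n i₂ ≤ n i₀ + n i₁ →
  (IsPalindrome (prefix w (n i₀ + n i₁ ∸ n i₂))
     ⇔ LinDep (vvec φ w n i₀) (vvec φ w n i₁) (vvec φ w n i₂))
  × (i₁ ≤ i₂ → n i₀ ≤ n i₂ + n i₁ → IsPalindrome (prefix w (n i₀ + n i₁ ∸ n i₂)))
  × (IsPalindrome (prefix w (n i₀ + n i₁ ∸ n i₂)) →
      (i : ℕ) → n i ≡ n i₀ + n i₁ ∸ n i₂ →
        ((bracket (vvec φ w n i₀) (vvec φ w n i₁) (vvec φ w n i₂) ≡ symMat (vvec φ w n i)
          ⊎ bracket (vvec φ w n i₀) (vvec φ w n i₁) (vvec φ w n i₂) ≡ negM (symMat (vvec φ w n i)))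
        × (pos (prefix w (n i)) ≈FG (pos (prefix w (n i₀)) ++ inv (pos (prefix w (n i₂))) ++ pos (prefix w (n i₁))))))
-- Non-periodicity, δ(w) < 2 and iⱼ ≥ 1 are standing assumptions of the paper not needed here.
lemma5p5 k w φ n _ (_ , increasing , palindromic) _ φ-injective φ≥1 i₀ i₁ i₂ _ _ _ lower upper =
  Symmetric-bracket⇔LinDep v₀ v₁ v₂ ⇔-∘ ⇔-sym Symmetric-bracket⇔palindrome ,
  palindromic-remainder ∘ increasing⇒monotone n increasing ,
  λ pal i → remainder-identities pal (n i)
  where
  palindrome : ∀ i → IsPalindrome (prefix w (n i))
  palindrome i = proj₂ (palindromic (n i)) i refl
  open Remainder φ-injective φ≥1 w (palindrome i₀) (palindrome i₁) (palindrome i₂) lower upper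
  v₀ v₁ v₂ : Vec3
  v₀ = vec (n i₀)
  v₁ = vec (n i₁)
  v₂ = vec (n i₂)
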